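{- Let $G$ be a strongly connected directed simple graph on vertex set $[n]$ and let $A\in\Theta_G$. For $k,l\in[n]$ and $\alpha\in\mathbb{C}$, let $A_{k,l,\alpha}$ be the matrix obtained from $A-\alpha I_n$ by removing row $k$ and column $l$. Then for sufficiently general $A$, $\det(A_{k,l,\alpha})\neq0$.
   Context: $\Theta_G\subseteq\mathbb{C}^{n\times n}$ is the linear space of matrices $A$ with $A_{ij}=0$ whenever $i\neq j$ and $j\to i$ is not an edge of $G$, all other entries (including the diagonal) free independent parameters. "Sufficiently general" means in some nonempty Zariski open subset of $\Theta_G$. -}

module Defs where

open import Level using (Level; _⊔_)
open import Algebra.Bundles using (CommutativeRing)
open import Data.Nat using (ℕ; zero; suc)
open import Data.Fin using (Fin; zero; suc; punchIn; _≟_)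
open import Data.List using (List; []; _∷_)
open import Data.List.Relation.Unary.Any using (Any)
open import Data.Product using (Σ; _×_; _,_; ∃)
open import Relation.Nullary using (¬_; yes; no)
open import Relation.Binary.PropositionalEquality using (_≡_)
open import Relation.Binary.Construct.Closure.ReflexiveTransitive using (Star)

-- Directed simple graphs on [n] = Fin n
-- An edge relation E with E i j meaning "i → j"; simple = no loops
-- (at most one edge i → j per ordered pair is automatic for a relation).

record DiGraph (n : ℕ) : Set₁ where
  field
    Edge   : Fin n → Fin n → Set
    noLoop : ∀ i → ¬ Edge i i

StronglyConnected : ∀ {n} → DiGraph n → Set
StronglyConnected {n} G = ∀ (i j : Fin n) → Star (DiGraph.Edge G) i j

module Over {c ℓ : Level} (R : CommutativeRing c ℓ) where
  open CommutativeRing R hiding (zero)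

  IsField : Set (c ⊔ ℓ)
  IsField = (1# ≉ 0#) × (∀ x → x ≉ 0# → Σ Carrier λ y → x * y ≈ 1#)

  natCast : ℕ → Carrier
  natCast zero    = 0#
  natCast (suc n) = 1# + natCast n

  CharZero : Set ℓ
  CharZero = ∀ n → natCast (suc n) ≉ 0#

  evalCoeffs : List Carrier → Carrier → Carrier
  evalCoeffs []       x = 0#
  evalCoeffs (a ∷ as) x = a + x * evalCoeffs as x

  -- every nonconstant monic polynomial  c₀ + … + c_{d-1} x^{d-1} + x^d  (d ≥ 1)
  -- has a root; the monic leading 1 is appended at the top.
  appendOne : List Carrier → List Carrier
  appendOne []       = 1# ∷ []
  appendOne (a ∷ as) = a ∷ appendOne as

  AlgClosed : Set (c ⊔ ℓ)
  AlgClosed = ∀ (a : Carrier) (as : List Carrier) →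
              Σ Carrier λ x → evalCoeffs (appendOne (a ∷ as)) x ≈ 0#

  Mat : ℕ → Set c
  Mat n = Fin n → Fin n → Carrier

  minor : ∀ {n} → Fin (suc n) → Fin (suc n) → Mat (suc n) → Mat n
  minor k l M i j = M (punchIn k i) (punchIn l j)

  altSum : ∀ {n} → (Fin n → Carrier) → Carrier
  altSum {zero}  f = 0#
  altSum {suc n} f = f zero - altSum {n} (λ j → f (suc j))

  det : ∀ {n} → Mat n → Carrier
  det {zero}  M = 1#
  det {suc n} M = altSum (λ j → M zero j * det (minor zero j M))

  identity : ∀ {n} → Mat n
  identity i j with i ≟ j
  ... | yes _ = 1#
  ... | no  _ = 0#

  shift : ∀ {n} → Mat n → Carrier → Mat n
  shift A α i j = A i j - α * identity i j

  InTheta : ∀ {n} → DiGraph n → Mat n → Set ℓ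
  InTheta G A = ∀ i j → ¬ (i ≡ j) → ¬ DiGraph.Edge G j i → A i j ≈ 0#

  data Poly (V : Set) : Set c where
    var  : V → Poly V
    con  : Carrier → Poly V
    _⊕_  : Poly V → Poly V → Poly V
    _⊗_  : Poly V → Poly V → Poly V

  evalPoly : ∀ {V} → Poly V → (V → Carrier) → Carrier
  evalPoly (var v) x = x v
  evalPoly (con a) x = a
  evalPoly (p ⊕ q) x = evalPoly p x + evalPoly q x
  evalPoly (p ⊗ q) x = evalPoly p x * evalPoly q x

  -- Zariski open subset of K^{n×n} given as the complement of the common
  -- zero locus of finitely many polynomials (Hilbert basis theorem: every
  -- Zariski open set is of this form). Open subsets of Θ_G carry the
  -- subspace topology: U ∩ Θ_G.
  InOpen : ∀ {n} → List (Poly (Fin n × Fin n)) → Mat n → Set (c ⊔ ℓ)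
  InOpen fs A = Any (λ f → evalPoly f (λ { (i , j) → A i j }) ≉ 0#) fs

  SufficientlyGeneral : ∀ {n} → DiGraph n → (Mat n → Set ℓ) → Set (c ⊔ ℓ)
  SufficientlyGeneral {n} G P =
    Σ (List (Poly (Fin n × Fin n))) λ fs →
      (Σ (Mat n) λ A → InTheta G A × InOpen fs A) ×
      (∀ A → InTheta G A → InOpen fs A → P A)

-- Since det (minor k l (shift A α)) is a polynomial in the entries of A, it suffices to find
-- one A ∈ Θ_G at which it does not vanish. Take a simple path k = v₀ → v₁ → ⋯ → v_r = l and
-- let σ send v_{t+1} to v_t and fix every other vertex. The matrix S with S i (σ i) = 1 and all
-- other entries 0 lies in Θ_G, and so does A = S + α I, with A − α I = S. Deleting row k and
-- column l from S leaves a permutation matrix, because σ maps [n] ∖ {k} bijectively onto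
-- [n] ∖ {l}; its determinant is ±1.
module Submission where

open import Defs
open import Level using (Level)
open import Algebra.Bundles using (CommutativeRing)
open import Data.Nat using (ℕ; suc)
open import Data.Fin using (Fin; zero; suc; punchIn; punchOut; _≟_)
open import Data.Fin.Properties
  using (punchIn-punchOut; punchOut-punchIn; punchOut-injective; punchOut-cong;
         punchInᵢ≢i; punchIn-injective; suc-injective)
open import Data.List using (List; []; _∷_)
open import Data.List.Relation.Unary.Any using (here; there)
open import Data.List.Membership.Propositional using (_∈_; _∉_)
open import Data.Product using (Σ; _×_; _,_; proj₁; proj₂)
open import Data.Sum using (_⊎_; inj₁; inj₂)
open import Data.Unit using (⊤; tt)
open import Data.Empty using (⊥-elim)
open import Function using (_∘_)
open import Function.Definitions using (Injective)
open import Relation.Nullary using (yes; no)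
open import Relation.Binary.PropositionalEquality as ≡ using (_≡_; _≢_; refl)
open import Relation.Binary.Construct.Closure.ReflexiveTransitive using (Star; ε; _◅_)

module Matrices {c ℓ : Level} (K : CommutativeRing c ℓ) where
  open CommutativeRing K renaming (refl to ≈-refl) hiding (zero)
  open Over K
  open import Algebra.Properties.Ring ring using (-‿involutive; -0#≈0#; -1*x≈-x)
  open import Relation.Binary.Reasoning.Setoid setoid

  IsSign : Carrier → Set ℓ
  IsSign x = (x ≈ 1#) ⊎ (x ≈ - 1#)

  IsSign-neg : ∀ {x} → IsSign x → IsSign (- x)
  IsSign-neg (inj₁ x≈1)  = inj₂ (-‿cong x≈1)
  IsSign-neg (inj₂ x≈-1) = inj₁ (trans (-‿cong x≈-1) (-‿involutive 1#))

  IsSign-resp : ∀ {x y} → x ≈ y → IsSign x → IsSign y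
  IsSign-resp x≈y (inj₁ x≈1)  = inj₁ (trans (sym x≈y) x≈1)
  IsSign-resp x≈y (inj₂ x≈-1) = inj₂ (trans (sym x≈y) x≈-1)

  IsSign⇒≉0 : 1# ≉ 0# → ∀ {x} → IsSign x → x ≉ 0#
  IsSign⇒≉0 1≉0 (inj₁ x≈1)  x≈0 = 1≉0 (trans (sym x≈1) x≈0)
  IsSign⇒≉0 1≉0 (inj₂ x≈-1) x≈0 = 1≉0 (begin
    1#     ≈⟨ sym (-‿involutive 1#) ⟩
    - - 1# ≈⟨ -‿cong (trans (sym x≈-1) x≈0) ⟩
    - 0#   ≈⟨ -0#≈0# ⟩
    0#     ∎)

  altSum-cong : ∀ {n} {f g : Fin n → Carrier} → (∀ j → f j ≈ g j) → altSum f ≈ altSum g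
  altSum-cong {ℕ.zero} f≈g = ≈-refl
  altSum-cong {suc n}  f≈g = +-cong (f≈g zero) (-‿cong (altSum-cong (λ j → f≈g (suc j))))

  altSum-zero : ∀ {n} (f : Fin n → Carrier) → (∀ j → f j ≈ 0#) → altSum f ≈ 0#
  altSum-zero {ℕ.zero} f f≈0 = ≈-refl
  altSum-zero {suc n}  f f≈0 = begin
    f zero - altSum (λ j → f (suc j)) ≈⟨ +-cong (f≈0 zero) (-‿cong (altSum-zero _ (λ j → f≈0 (suc j)))) ⟩
    0# - 0#                           ≈⟨ +-identityˡ _ ⟩
    - 0#                              ≈⟨ -0#≈0# ⟩
    0#                                ∎

  altSum-single : ∀ {n} (f : Fin n → Carrier) (j₀ : Fin n) → (∀ j → j ≢ j₀ → f j ≈ 0#) →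
                  (altSum f ≈ f j₀) ⊎ (altSum f ≈ - f j₀)
  altSum-single {suc n} f zero f≈0 = inj₁ (begin
    f zero - altSum (λ j → f (suc j)) ≈⟨ +-congˡ (-‿cong (altSum-zero _ (λ j → f≈0 (suc j) (λ ())))) ⟩
    f zero - 0#                       ≈⟨ +-congˡ -0#≈0# ⟩
    f zero + 0#                       ≈⟨ +-identityʳ _ ⟩
    f zero                            ∎)
  altSum-single {suc n} f (suc j₀) f≈0
    with altSum-single (λ j → f (suc j)) j₀ (λ j j≢j₀ → f≈0 (suc j) (j≢j₀ ∘ suc-injective))
  ... | inj₁ tail≈ = inj₂ (begin
    f zero - altSum (λ j → f (suc j)) ≈⟨ +-cong (f≈0 zero (λ ())) (-‿cong tail≈) ⟩
    0# - f (suc j₀)                   ≈⟨ +-identityˡ _ ⟩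
    - f (suc j₀)                      ∎)
  ... | inj₂ tail≈ = inj₁ (begin
    f zero - altSum (λ j → f (suc j)) ≈⟨ +-cong (f≈0 zero (λ ())) (-‿cong tail≈) ⟩
    0# - - f (suc j₀)                 ≈⟨ +-identityˡ _ ⟩
    - - f (suc j₀)                    ≈⟨ -‿involutive _ ⟩
    f (suc j₀)                        ∎)

  altSum-single-sign : ∀ {n} (f : Fin n → Carrier) (j₀ : Fin n) → (∀ j → j ≢ j₀ → f j ≈ 0#) →
                       IsSign (f j₀) → IsSign (altSum f)
  altSum-single-sign f j₀ f≈0 fj₀-sign with altSum-single f j₀ f≈0
  ... | inj₁ sum≈ = IsSign-resp (sym sum≈) fj₀-sign
  ... | inj₂ sum≈ = IsSign-resp (sym sum≈) (IsSign-neg fj₀-sign)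

  det-cong : ∀ {n} {M N : Mat n} → (∀ i j → M i j ≈ N i j) → det M ≈ det N
  det-cong {ℕ.zero} M≈N = ≈-refl
  det-cong {suc n}  M≈N = altSum-cong (λ j → *-cong (M≈N zero j) (det-cong (λ a b → M≈N (suc a) (punchIn j b))))

  IsPermutationMatrix : ∀ {n} → Mat n → (Fin n → Fin n) → Set ℓ
  IsPermutationMatrix M τ = ∀ i j → (j ≡ τ i → M i j ≈ 1#) × (j ≢ τ i → M i j ≈ 0#)

  det-permutationMatrix : ∀ {n} (M : Mat n) (τ : Fin n → Fin n) → Injective _≡_ _≡_ τ →
                          IsPermutationMatrix M τ → IsSign (det M)
  det-permutationMatrix {ℕ.zero} M τ τ-inj M-perm = inj₁ ≈-refl
  det-permutationMatrix {suc n}  M τ τ-inj M-perm =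
    altSum-single-sign term (τ zero)
      (λ j j≢τ₀ → trans (*-congʳ (proj₂ (M-perm zero j) j≢τ₀)) (zeroˡ _))
      (IsSign-resp (sym term-τ₀) (det-permutationMatrix _ τ′ τ′-inj minor-perm))
    where
      τ₀≢τsuc : ∀ i → τ zero ≢ τ (suc i)
      τ₀≢τsuc i τ₀≡τi with τ-inj τ₀≡τi
      ... | ()

      τ′ : Fin n → Fin n
      τ′ i = punchOut (τ₀≢τsuc i)

      τ′-inj : Injective _≡_ _≡_ τ′
      τ′-inj τ′a≡τ′b = suc-injective (τ-inj (punchOut-injective (τ₀≢τsuc _) (τ₀≢τsuc _) τ′a≡τ′b))

      minor-perm : IsPermutationMatrix (minor zero (τ zero) M) τ′
      minor-perm i j =
          (λ j≡τ′i → proj₁ (M-perm (suc i) (punchIn (τ zero) j))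
                       (≡.trans (≡.cong (punchIn (τ zero)) j≡τ′i) (punchIn-punchOut (τ₀≢τsuc i))))
        , (λ j≢τ′i → proj₂ (M-perm (suc i) (punchIn (τ zero) j))
                       (λ e → j≢τ′i (≡.trans (≡.sym (punchOut-punchIn (τ zero))) (punchOut-cong (τ zero) e))))

      term : Fin (suc n) → Carrier
      term j = M zero j * det (minor zero j M)

      term-τ₀ : term (τ zero) ≈ det (minor zero (τ zero) M)
      term-τ₀ = trans (*-congʳ (proj₁ (M-perm zero (τ zero)) refl)) (*-identityˡ _)

  identity-≡ : ∀ {n} {i j : Fin n} → i ≡ j → identity i j ≡ 1#
  identity-≡ {i = i} {j} i≡j with i ≟ j
  ... | yes _    = refl
  ... | no  i≢j = ⊥-elim (i≢j i≡j)

  identity-≢ : ∀ {n} {i j : Fin n} → i ≢ j → identity i j ≡ 0#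
  identity-≢ {i = i} {j} i≢j with i ≟ j
  ... | yes i≡j = ⊥-elim (i≢j i≡j)
  ... | no  _   = refl

  addScalar : ∀ {n} → Mat n → Carrier → Mat n
  addScalar S α i j = S i j + α * identity i j

  shift-addScalar : ∀ {n} (S : Mat n) α i j → shift (addScalar S α) α i j ≈ S i j
  shift-addScalar S α i j = begin
    (S i j + α * identity i j) - α * identity i j ≈⟨ +-assoc _ _ _ ⟩
    S i j + (α * identity i j - α * identity i j) ≈⟨ +-congˡ (-‿inverseʳ _) ⟩
    S i j + 0#                                    ≈⟨ +-identityʳ _ ⟩
    S i j                                         ∎

  InTheta-addScalar : ∀ {n} {G : DiGraph n} {S : Mat n} α → InTheta G S → InTheta G (addScalar S α)
  InTheta-addScalar {S = S} α S∈Θ i j i≢j ¬j→i = begin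
    S i j + α * identity i j ≈⟨ +-cong (S∈Θ i j i≢j ¬j→i) (*-congˡ (reflexive (identity-≢ i≢j))) ⟩
    0# + α * 0#              ≈⟨ +-identityˡ _ ⟩
    α * 0#                   ≈⟨ zeroʳ _ ⟩
    0#                       ∎

  altSumPoly : ∀ {V n} → (Fin n → Poly V) → Poly V
  altSumPoly {n = ℕ.zero} f = con 0#
  altSumPoly {n = suc n}  f = f zero ⊕ (con (- 1#) ⊗ altSumPoly (λ j → f (suc j)))

  detPoly : ∀ {V n} → (Fin n → Fin n → Poly V) → Poly V
  detPoly {n = ℕ.zero} Q = con 1#
  detPoly {n = suc n}  Q = altSumPoly (λ j → Q zero j ⊗ detPoly (λ a b → Q (suc a) (punchIn j b)))

  evalPoly-altSumPoly : ∀ {V n} (f : Fin n → Poly V) x →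
                        evalPoly (altSumPoly f) x ≈ altSum (λ j → evalPoly (f j) x)
  evalPoly-altSumPoly {n = ℕ.zero} f x = ≈-refl
  evalPoly-altSumPoly {n = suc n}  f x =
    +-congˡ (trans (*-congˡ (evalPoly-altSumPoly (λ j → f (suc j)) x)) (-1*x≈-x _))

  evalPoly-detPoly : ∀ {V n} (Q : Fin n → Fin n → Poly V) x →
                     evalPoly (detPoly Q) x ≈ det (λ a b → evalPoly (Q a b) x)
  evalPoly-detPoly {n = ℕ.zero} Q x = ≈-refl
  evalPoly-detPoly {n = suc n}  Q x =
    trans (evalPoly-altSumPoly (λ j → Q zero j ⊗ detPoly (λ a b → Q (suc a) (punchIn j b))) x)
          (altSum-cong (λ j → *-congˡ {evalPoly (Q zero j) x} (evalPoly-detPoly (λ a b → Q (suc a) (punchIn j b)) x)))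

  sufficientlyGeneral-minorDet≉0 :
    ∀ {m} (G : DiGraph (suc m)) (k l : Fin (suc m)) α →
    (Σ (Mat (suc m)) λ A → InTheta G A × det (minor k l (shift A α)) ≉ 0#) →
    SufficientlyGeneral G (λ A → det (minor k l (shift A α)) ≉ 0#)
  sufficientlyGeneral-minorDet≉0 {m} G k l α (A , A∈Θ , detA≉0) =
    detPoly minorPoly ∷ [] , (A , A∈Θ , here (detA≉0 ∘ trans (sym (evalMinor A))))
      , λ { B _ (here detB≉0) → detB≉0 ∘ trans (evalMinor B) }
    where
      minorPoly : Fin m → Fin m → Poly (Fin (suc m) × Fin (suc m))
      minorPoly a b = var (punchIn k a , punchIn l b) ⊕ con (- (α * identity (punchIn k a) (punchIn l b)))

      evalMinor : ∀ B → evalPoly (detPoly minorPoly) (λ { (i , j) → B i j }) ≈ det (minor k l (shift B α))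
      evalMinor B = evalPoly-detPoly minorPoly _

module Paths {n : ℕ} (E : Fin n → Fin n → Set) (l : Fin n) where
  open import Data.List.Membership.DecPropositional (_≟_ {n}) using (_∈?_)

  Path : Fin n → Set
  Path j = Star E j l

  vertices : ∀ {j} → Path j → List (Fin n)
  vertices {j} ε       = j ∷ []
  vertices {j} (_ ◅ p) = j ∷ vertices p

  IsSimple : ∀ {j} → Path j → Set
  IsSimple ε           = ⊤
  IsSimple {j} (_ ◅ p) = j ∉ vertices p × IsSimple p

  start∈vertices : ∀ {j} (p : Path j) → j ∈ vertices p
  start∈vertices ε       = here refl
  start∈vertices (_ ◅ p) = here refl

  end∈vertices : ∀ {j} (p : Path j) → l ∈ vertices p
  end∈vertices ε       = here refl
  end∈vertices (_ ◅ p) = there (end∈vertices p)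

  suffix : ∀ {i j} (p : Path i) → j ∈ vertices p → IsSimple p → Σ (Path j) IsSimple
  suffix ε       (here refl) p-simple       = ε , tt
  suffix (e ◅ p) (here refl) p-simple       = e ◅ p , p-simple
  suffix (e ◅ p) (there j∈p) (_ , p-simple) = suffix p j∈p p-simple

  -- Loop erasure: a repeated vertex is skipped by jumping to its later occurrence.
  simplePath : ∀ {j} → Path j → Σ (Path j) IsSimple
  simplePath ε = ε , tt
  simplePath {j} (e ◅ p) with simplePath p
  ... | q , q-simple with j ∈? vertices q
  ...   | yes j∈q = suffix q j∈q q-simple
  ...   | no  j∉q = e ◅ q , j∉q , q-simple

  predecessor : ∀ {j} → Path j → Fin n → Fin n
  predecessor ε i = i
  predecessor {j} (_◅_ {j = j′} _ p) i with i ≟ j′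
  ... | yes _ = j
  ... | no  _ = predecessor p i

  predecessor-fixed⊎edge : ∀ {j} (p : Path j) i → predecessor p i ≡ i ⊎ E (predecessor p i) i
  predecessor-fixed⊎edge ε i = inj₁ refl
  predecessor-fixed⊎edge (_◅_ {j = j′} e p) i with i ≟ j′
  ... | yes refl = inj₂ e
  ... | no  _    = predecessor-fixed⊎edge p i

  predecessor-∉ : ∀ {j} (p : Path j) {i} → i ∉ vertices p → predecessor p i ≡ i
  predecessor-∉ ε i∉p = refl
  predecessor-∉ (_◅_ {j = j′} _ p) {i} i∉p with i ≟ j′
  ... | yes refl = ⊥-elim (i∉p (there (start∈vertices p)))
  ... | no  _    = predecessor-∉ p (i∉p ∘ there)

  predecessor-∈ : ∀ {j} (p : Path j) → IsSimple p → ∀ {i} → i ∈ vertices p → predecessor p i ∈ vertices p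
  predecessor-∈ ε _ i∈p = i∈p
  predecessor-∈ (_◅_ {j = j′} _ p) (j∉p , p-simple) {i} i∈p with i ≟ j′
  predecessor-∈ (_ ◅ p) (j∉p , p-simple) _           | yes _ = here refl
  predecessor-∈ (_ ◅ p) (j∉p , p-simple) (here refl) | no  _ = here (predecessor-∉ p j∉p)
  predecessor-∈ (_ ◅ p) (j∉p , p-simple) (there i∈p) | no  _ = there (predecessor-∈ p p-simple i∈p)

  predecessor-≢end : ∀ {j} (p : Path j) → IsSimple p → ∀ {i} → i ≢ j → predecessor p i ≢ l
  predecessor-≢end ε _ i≢j = i≢j
  predecessor-≢end (_◅_ {j = j′} _ p) (j∉p , p-simple) {i} i≢j with i ≟ j′
  ... | yes _   = λ j≡l → j∉p (≡.subst (_∈ vertices p) (≡.sym j≡l) (end∈vertices p))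
  ... | no i≢j′ = predecessor-≢end p p-simple i≢j′

  ∉⇒≢predecessor : ∀ {i j} (p : Path i) → IsSimple p → j ∉ vertices p →
                   ∀ {b} → b ≢ j → j ≢ predecessor p b
  ∉⇒≢predecessor p p-simple j∉p {b} b≢j j≡pb with b ∈? vertices p
  ... | yes b∈p = j∉p (≡.subst (_∈ vertices p) (≡.sym j≡pb) (predecessor-∈ p p-simple b∈p))
  ... | no  b∉p = b≢j (≡.sym (≡.trans j≡pb (predecessor-∉ p b∉p)))

  predecessor-injective : ∀ {j} (p : Path j) → IsSimple p → ∀ {a b} → a ≢ j → b ≢ j →
                          predecessor p a ≡ predecessor p b → a ≡ b
  predecessor-injective ε _ _ _ pa≡pb = pa≡pb
  predecessor-injective (_◅_ {j = j′} _ p) (j∉p , p-simple) {a} {b} a≢j b≢j pa≡pb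
    with a ≟ j′ | b ≟ j′
  ... | yes a≡j′ | yes b≡j′ = ≡.trans a≡j′ (≡.sym b≡j′)
  ... | yes _    | no  _    = ⊥-elim (∉⇒≢predecessor p p-simple j∉p b≢j pa≡pb)
  ... | no  _    | yes _    = ⊥-elim (∉⇒≢predecessor p p-simple j∉p a≢j (≡.sym pa≡pb))
  ... | no a≢j′  | no b≢j′  = predecessor-injective p p-simple a≢j′ b≢j′ pa≡pb

module PathMatrix {c ℓ : Level} (K : CommutativeRing c ℓ) {m : ℕ} (G : DiGraph (suc m))
                  (k l : Fin (suc m)) where
  open CommutativeRing K using (reflexive)
  open Over K
  open Matrices K
  open Paths (DiGraph.Edge G) l

  pathMatrix : Path k → Mat (suc m)
  pathMatrix p i j = identity j (predecessor p i)

  pathMatrix∈Θ : ∀ p → InTheta G (pathMatrix p)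
  pathMatrix∈Θ p i j i≢j ¬j→i with j ≟ predecessor p i | predecessor-fixed⊎edge p i
  ... | no  _    | _         = reflexive refl
  ... | yes j≡pi | inj₁ pi≡i = ⊥-elim (i≢j (≡.sym (≡.trans j≡pi pi≡i)))
  ... | yes j≡pi | inj₂ pi→i = ⊥-elim (¬j→i (≡.subst (λ v → DiGraph.Edge G v i) (≡.sym j≡pi) pi→i))

  minor-pathMatrix-det : ∀ (p : Path k) → IsSimple p → IsSign (det (minor k l (pathMatrix p)))
  minor-pathMatrix-det p p-simple = det-permutationMatrix _ τ τ-inj τ-perm
    where
      l≢p : ∀ a → l ≢ predecessor p (punchIn k a)
      l≢p a = predecessor-≢end p p-simple (punchInᵢ≢i k a) ∘ ≡.sym

      τ : Fin m → Fin m
      τ a = punchOut (l≢p a)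

      τ-inj : Injective _≡_ _≡_ τ
      τ-inj {a} {b} τa≡τb = punchIn-injective k a b
        (predecessor-injective p p-simple (punchInᵢ≢i k a) (punchInᵢ≢i k b)
          (punchOut-injective (l≢p a) (l≢p b) τa≡τb))

      τ-perm : IsPermutationMatrix (minor k l (pathMatrix p)) τ
      τ-perm a b =
          (λ b≡τa → reflexive (identity-≡
                      (≡.trans (≡.cong (punchIn l) b≡τa) (punchIn-punchOut (l≢p a)))))
        , (λ b≢τa → reflexive (identity-≢
                      (λ e → b≢τa (≡.trans (≡.sym (punchOut-punchIn l)) (punchOut-cong l e)))))

lemma4p11 : ∀ {c ℓ : Level} (K : CommutativeRing c ℓ) →
              Over.IsField K → Over.CharZero K → Over.AlgClosed K →
              (m : ℕ) (G : DiGraph (suc m)) → StronglyConnected G →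
              (k l : Fin (suc m)) (α : CommutativeRing.Carrier K) →
              Over.SufficientlyGeneral K G
                (λ A → CommutativeRing._≉_ K (Over.det K (Over.minor K k l (Over.shift K A α)))
                                  (CommutativeRing.0# K))
lemma4p11 K (1≉0 , _) _ _ m G sc k l α =
  sufficientlyGeneral-minorDet≉0 G k l α
    ( addScalar (pathMatrix p) α
    , InTheta-addScalar {G = G} α (pathMatrix∈Θ p)
    , IsSign⇒≉0 1≉0 (IsSign-resp (sym shifted-minor≈) (minor-pathMatrix-det p p-simple)))
  where
    open CommutativeRing K using (_≈_; sym)
    open Over K using (det; minor; shift)
    open Matrices K
    open Paths (DiGraph.Edge G) l
    open PathMatrix K G k l

    p : Path k
    p = proj₁ (simplePath (sc k l))

    p-simple : IsSimple p
    p-simple = proj₂ (simplePath (sc k l))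

    shifted-minor≈ : det (minor k l (shift (addScalar (pathMatrix p) α) α)) ≈ det (minor k l (pathMatrix p))
    shifted-minor≈ = det-cong (λ a b → shift-addScalar (pathMatrix p) α (punchIn k a) (punchIn l b))
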